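{- In the Slow Flashcard Game, for all $n\ge 1$ we have $T_n(1)\le (n-1)^2+1$.
   Context: The Slow Flashcard Game is the following deterministic process with insertion sequence $p_k=k+1$. The state at each time $t=1,2,\dots$ consists of an ordering (the deck) of all positive integers (cards), positions numbered $1,2,\dots$ from the front, together with a counter for each card recording how many times it has been seen. At time $t=1$ the deck is $1,2,3,\dots$, card $1$ (at the front) has been seen once, and all other cards $0$ times. To pass from time $t$ to $t+1$: if the front card has been seen $k$ times so far, remove it and reinsert it so that it occupies position $k+1$; then the card now at the front has its counter increased by one (it is seen at time $t+1$). For $n,k\ge1$, $T_n(k)$ denotes the time at which card $n$ is seen for the $k$-th time. -}

module Defs where

open import Data.Nat using (ℕ; zero; suc; _<ᵇ_; _≡ᵇ_)
open import Data.Bool using (if_then_else_)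
open import Data.Product using (_×_)
open import Relation.Binary.PropositionalEquality using (_≡_)

-- State of the Slow Flashcard Game.
-- deck i  = the card at position i+1 (positions are 1,2,3,... ; index i is 0-based)
-- count m = how many times card m has been seen so far
record State : Set where
  constructor mkState
  field
    deck  : ℕ → ℕ
    count : ℕ → ℕ
open State public

-- time 1: deck 1,2,3,... ; card 1 seen once, all others 0 times
initState : State
initState = mkState (λ i → suc i) (λ m → if m ≡ᵇ 1 then 1 else 0)

-- remove the front card c (seen k times) and reinsert it so it occupies
-- position k+1 (insertion sequence p_k = k+1), i.e. 0-based index k
reinsert : (ℕ → ℕ) → ℕ → (ℕ → ℕ)
reinsert d k i = if i <ᵇ k then d (suc i) else (if i ≡ᵇ k then d 0 else d i)

step : State → State
step s = mkState d' c'
  where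
    d' : ℕ → ℕ
    d' = reinsert (deck s) (count s (deck s 0))
    c' : ℕ → ℕ
    c' m = if m ≡ᵇ d' 0 then suc (count s m) else count s m

-- stateAt t = the state at time t, for t ≥ 1 (stateAt 0 is junk = initState)
stateAt : ℕ → State
stateAt zero = initState
stateAt (suc zero) = initState
stateAt (suc (suc t)) = step (stateAt (suc t))

-- card n is seen for the k-th time at time t  (i.e. T_n(k) = t)
SeenKthAt : ℕ → ℕ → ℕ → Set
SeenKthAt n k t = deck (stateAt t) 0 ≡ n × count (stateAt t) n ≡ k

-- While card n = p + 2 has not yet been seen, it sits at some index j ≥ 1 and only
-- cards from 1, …, p + 1 lie in front of it; those behind the front card have been
-- seen at most p times, and every card of 1, …, p + 1 at most p + 1 times.  Each step before n
-- reaches the front shows one of the cards 1, …, p + 1, so the total number of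
-- sightings of these cards equals the time t.  That total is at most (p + 1)², so
-- card n must reach the front by time (p + 1)² + 1 = (n - 1)² + 1.
module Submission where

open import Defs
open import Data.Nat using (ℕ; zero; suc; _≤_; _<_; _+_; _*_; _∸_; z≤n; s≤s; z<s; _<ᵇ_; _≡ᵇ_)
open import Data.Nat.Properties
open import Data.Bool using (true; false; if_then_else_)
open import Data.Product using (Σ; _×_; _,_; proj₁; proj₂)
open import Data.Sum using (_⊎_; inj₁; inj₂)
open import Function using (_∘′_)
open import Function.Definitions using (Injective)
open import Relation.Nullary using (yes; no; contradiction)
open import Relation.Binary.PropositionalEquality
open import Relation.Binary using (tri<; tri≈; tri>)

<ᵇ-true : ∀ {m n} → m < n → (m <ᵇ n) ≡ true
<ᵇ-true {zero}  {suc n} _         = refl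
<ᵇ-true {suc m} {suc n} (s≤s m<n) = <ᵇ-true m<n

<ᵇ-false : ∀ {m n} → n ≤ m → (m <ᵇ n) ≡ false
<ᵇ-false {m}     {zero}  _         = refl
<ᵇ-false {suc m} {suc n} (s≤s n≤m) = <ᵇ-false n≤m

≡ᵇ-refl : ∀ m → (m ≡ᵇ m) ≡ true
≡ᵇ-refl zero    = refl
≡ᵇ-refl (suc m) = ≡ᵇ-refl m

≡ᵇ-false : ∀ {m n} → m ≢ n → (m ≡ᵇ n) ≡ false
≡ᵇ-false {zero}  {zero}  m≢n = contradiction refl m≢n
≡ᵇ-false {zero}  {suc n} _   = refl
≡ᵇ-false {suc m} {zero}  _   = refl
≡ᵇ-false {suc m} {suc n} m≢n = ≡ᵇ-false (m≢n ∘′ cong suc)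

-- reinsert d k = d ∘ oldIndex k : the card now at index i was at index oldIndex k i,
-- and the card that was at index j is now at index newIndex k j.
oldIndex : ℕ → ℕ → ℕ
oldIndex k i = if i <ᵇ k then suc i else (if i ≡ᵇ k then 0 else i)

newIndex : ℕ → ℕ → ℕ
newIndex k zero    = k
newIndex k (suc j) = if j <ᵇ k then j else suc j

reinsert-oldIndex : ∀ d k i → reinsert d k i ≡ d (oldIndex k i)
reinsert-oldIndex d k i with i <ᵇ k
... | true = refl
... | false with i ≡ᵇ k
...   | true  = refl
...   | false = refl

oldIndex-< : ∀ {k i} → i < k → oldIndex k i ≡ suc i
oldIndex-< i<k rewrite <ᵇ-true i<k = refl

oldIndex-self : ∀ k → oldIndex k k ≡ 0
oldIndex-self k rewrite <ᵇ-false (≤-refl {k}) | ≡ᵇ-refl k = refl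

oldIndex-> : ∀ {k i} → k < i → oldIndex k i ≡ i
oldIndex-> {k} {i} k<i rewrite <ᵇ-false (<⇒≤ k<i) | ≡ᵇ-false (>⇒≢ k<i) = refl

newIndex-suc-< : ∀ {k j} → j < k → newIndex k (suc j) ≡ j
newIndex-suc-< j<k rewrite <ᵇ-true j<k = refl

newIndex-suc-≥ : ∀ {k j} → k ≤ j → newIndex k (suc j) ≡ suc j
newIndex-suc-≥ k≤j rewrite <ᵇ-false k≤j = refl

newIndex-oldIndex : ∀ k i → newIndex k (oldIndex k i) ≡ i
newIndex-oldIndex k i with <-cmp i k
... | tri< i<k _ _        rewrite oldIndex-< i<k  = newIndex-suc-< i<k
... | tri≈ _ refl _       rewrite oldIndex-self k = refl
... | tri> _ _ (s≤s k≤i′) rewrite oldIndex-> (s≤s k≤i′) = newIndex-suc-≥ k≤i′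

oldIndex-newIndex : ∀ k j → oldIndex k (newIndex k j) ≡ j
oldIndex-newIndex k zero = oldIndex-self k
oldIndex-newIndex k (suc j) with j <? k
... | yes j<k rewrite newIndex-suc-< j<k = oldIndex-< j<k
... | no  j≮k rewrite newIndex-suc-≥ (≮⇒≥ j≮k) = oldIndex-> (s≤s (≮⇒≥ j≮k))

oldIndex-injective : ∀ k → Injective _≡_ _≡_ (oldIndex k)
oldIndex-injective k {a} {b} eq = begin
  a                          ≡⟨ newIndex-oldIndex k a ⟨
  newIndex k (oldIndex k a)  ≡⟨ cong (newIndex k) eq ⟩
  newIndex k (oldIndex k b)  ≡⟨ newIndex-oldIndex k b ⟩
  b                          ∎
  where open ≡-Reasoning

oldIndex≡0⇒≡ : ∀ {k i} → oldIndex k i ≡ 0 → i ≡ k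
oldIndex≡0⇒≡ {k} {i} eq = trans (sym (newIndex-oldIndex k i)) (cong (newIndex k) eq)

j≤newIndex-suc : ∀ k j → j ≤ newIndex k (suc j)
j≤newIndex-suc k j with j <? k
... | yes j<k rewrite newIndex-suc-< j<k = ≤-refl
... | no  j≮k rewrite newIndex-suc-≥ (≮⇒≥ j≮k) = n≤1+n j

newIndex-suc≤ : ∀ k j → newIndex k (suc j) ≤ suc j
newIndex-suc≤ k j with j <? k
... | yes j<k rewrite newIndex-suc-< j<k = n≤1+n j
... | no  j≮k rewrite newIndex-suc-≥ (≮⇒≥ j≮k) = ≤-refl

before-newIndex : ∀ {k i j} → i < k → i < newIndex k (suc j) → i < j
before-newIndex {k} {i} {j} i<k i<new with j <? k
... | yes j<k = subst (i <_) (newIndex-suc-< j<k) i<new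
... | no  j≮k = ≤-trans i<k (≮⇒≥ j≮k)

oldIndex-<-newIndex : ∀ k j {i} → i < newIndex k (suc j) → oldIndex k i < suc j
oldIndex-<-newIndex k j {i} i<new with <-cmp i k
... | tri< i<k _ _ rewrite oldIndex-< i<k = s≤s (before-newIndex i<k i<new)
... | tri≈ _ i≡k _ rewrite i≡k | oldIndex-self k = z<s
... | tri> _ _ k<i rewrite oldIndex-> k<i = ≤-trans i<new (newIndex-suc≤ k j)

deck-step : ∀ s i → deck (step s) i ≡ deck s (oldIndex (count s (deck s 0)) i)
deck-step s = reinsert-oldIndex (deck s) (count s (deck s 0))

front-step : ∀ s → 1 ≤ count s (deck s 0) → deck (step s) 0 ≡ deck s 1
front-step s seen = trans (deck-step s 0) (cong (deck s) (oldIndex-< seen))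

count-step-front : ∀ s → count (step s) (deck (step s) 0) ≡ suc (count s (deck (step s) 0))
count-step-front s rewrite ≡ᵇ-refl (deck (step s) 0) = refl

count-step-other : ∀ s {m} → m ≢ deck (step s) 0 → count (step s) m ≡ count s m
count-step-other s m≢front rewrite ≡ᵇ-false m≢front = refl

deck-step-injective : ∀ s → Injective _≡_ _≡_ (deck s) → Injective _≡_ _≡_ (deck (step s))
deck-step-injective s inj {a} {b} eq = oldIndex-injective k (inj (begin
  deck s (oldIndex k a)  ≡⟨ deck-step s a ⟨
  deck (step s) a        ≡⟨ eq ⟩
  deck (step s) b        ≡⟨ deck-step s b ⟩
  deck s (oldIndex k b)  ∎))
  where
    k = count s (deck s 0)
    open ≡-Reasoning

deck-injective : ∀ t → Injective _≡_ _≡_ (deck (stateAt t))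
deck-injective zero          = suc-injective
deck-injective (suc zero)    = suc-injective
deck-injective (suc (suc t)) = deck-step-injective (stateAt (suc t)) (deck-injective (suc t))

sumTo : ℕ → (ℕ → ℕ) → ℕ
sumTo zero    f = 0
sumTo (suc k) f = f (suc k) + sumTo k f

sumTo-cong : ∀ k {f g} → (∀ {m} → m ≤ k → f m ≡ g m) → sumTo k f ≡ sumTo k g
sumTo-cong zero    f≡g = refl
sumTo-cong (suc k) f≡g = cong₂ _+_ (f≡g ≤-refl) (sumTo-cong k (f≡g ∘′ m≤n⇒m≤1+n))

sumTo-≤ : ∀ k {f B} → (∀ {m} → 1 ≤ m → m ≤ k → f m ≤ B) → sumTo k f ≤ k * B
sumTo-≤ zero    f≤B = z≤n
sumTo-≤ (suc k) f≤B = +-mono-≤ (f≤B z<s ≤-refl) (sumTo-≤ k (λ 1≤m m≤k → f≤B 1≤m (m≤n⇒m≤1+n m≤k)))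

sumTo-increment : ∀ k {f g x} → 1 ≤ x → x ≤ k → g x ≡ suc (f x) → (∀ {m} → m ≢ x → g m ≡ f m) →
  sumTo k g ≡ suc (sumTo k f)
sumTo-increment zero    1≤x x≤0 _ _ = contradiction (≤-trans 1≤x x≤0) λ ()
sumTo-increment (suc k) {f} {g} {x} 1≤x x≤1+k gx≡ g≡f with suc k ≟ x
... | yes refl = cong₂ _+_ gx≡ (sumTo-cong k (λ m≤k → g≡f (<⇒≢ (s≤s m≤k))))
... | no  1+k≢x = begin
  g (suc k) + sumTo k g       ≡⟨ cong₂ _+_ (g≡f 1+k≢x) (sumTo-increment k 1≤x x≤k gx≡ g≡f) ⟩
  f (suc k) + suc (sumTo k f) ≡⟨ +-suc (f (suc k)) (sumTo k f) ⟩
  suc (sumTo (suc k) f)       ∎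
  where
    x≤k = ≤-pred (≤∧≢⇒< x≤1+k (1+k≢x ∘′ sym))
    open ≡-Reasoning

module FirstSighting (p : ℕ) where

  n : ℕ
  n = suc (suc p)

  record Waiting (s : State) (j : ℕ) : Set where
    field
      1≤j          : 1 ≤ j
      j≤1+p        : j ≤ suc p
      deck-j       : deck s j ≡ n
      ahead-cards  : ∀ {i} → i < j → 1 ≤ deck s i × deck s i ≤ suc p
      ahead-counts : ∀ {i} → 1 ≤ i → i < j → count s (deck s i) ≤ p
      front-seen   : 1 ≤ count s (deck s 0)
      counts≤      : ∀ {m} → 1 ≤ m → m ≤ suc p → count s m ≤ suc p
      n-unseen     : count s n ≡ 0

  sightings : State → ℕ
  sightings s = sumTo (suc p) (count s)

  waiting-initial : Waiting (stateAt 1) (suc p)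
  waiting-initial = record
    { 1≤j          = z<s
    ; j≤1+p        = ≤-refl
    ; deck-j       = refl
    ; ahead-cards  = λ i<1+p → z<s , i<1+p
    ; ahead-counts = λ { {suc i} _ _ → z≤n }
    ; front-seen   = z<s
    ; counts≤      = λ { {suc zero} _ _ → s≤s z≤n ; {suc (suc m)} _ _ → z≤n }
    ; n-unseen     = refl
    }

  sightings-initial : sightings (stateAt 1) ≡ 1
  sightings-initial = go p
    where
      go : ∀ k → sumTo (suc k) (count initState) ≡ 1
      go zero    = refl
      go (suc k) = go k

  module _ {s j} (w : Waiting s (suc (suc j))) where
    open Waiting w

    private
      k = count s (deck s 0)
      front′ = deck (step s) 0

      front′≡ : front′ ≡ deck s 1
      front′≡ = front-step s front-seen

      front′-range : 1 ≤ front′ × front′ ≤ suc p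
      front′-range rewrite front′≡ = ahead-cards (s≤s z<s)

    sightings-step : sightings (step s) ≡ suc (sightings s)
    sightings-step = sumTo-increment (suc p) (proj₁ front′-range) (proj₂ front′-range)
      (count-step-front s) (count-step-other s)

    waiting-step : Injective _≡_ _≡_ (deck s) → Waiting (step s) (newIndex k (suc (suc j)))
    waiting-step inj = record
      { 1≤j          = ≤-trans (s≤s z≤n) (j≤newIndex-suc k (suc j))
      ; j≤1+p        = ≤-trans (newIndex-suc≤ k (suc j)) j≤1+p
      ; deck-j       = trans (deck-step s j′) (trans (cong (deck s) (oldIndex-newIndex k (suc (suc j)))) deck-j)
      ; ahead-cards  = λ {i} i<j′ → subst (λ c → 1 ≤ c × c ≤ suc p) (sym (deck-step s i))
                                      (ahead-cards (oldIndex-<-newIndex k (suc j) i<j′))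
      ; ahead-counts = ahead-counts′
      ; front-seen   = subst (1 ≤_) (sym (count-step-front s)) z<s
      ; counts≤      = counts≤′
      ; n-unseen     = trans (count-step-other s n≢front′) n-unseen
      }
      where
        j′ = newIndex k (suc (suc j))

        n≢front′ : n ≢ front′
        n≢front′ n≡front′ = <⇒≢ (s≤s (proj₂ front′-range)) (sym n≡front′)

        counts≤′ : ∀ {m} → 1 ≤ m → m ≤ suc p → count (step s) m ≤ suc p
        counts≤′ {m} 1≤m m≤1+p with m ≟ front′
        ... | yes refl rewrite count-step-front s | front′≡ = s≤s (ahead-counts ≤-refl (s≤s z<s))
        ... | no  m≢front′ rewrite count-step-other s m≢front′ = counts≤ 1≤m m≤1+p

        -- A card in front of n that was the old front card was reinserted at index k.
        old-count≤ : ∀ {i} → i < j′ → count s (deck s (oldIndex k i)) ≤ p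
        old-count≤ {i} i<j′ with oldIndex k i in eq
        ... | zero  = ≤-pred (≤-trans (subst (_< j′) (oldIndex≡0⇒≡ eq) i<j′)
                                      (≤-trans (newIndex-suc≤ k (suc j)) j≤1+p))
        ... | suc _ = ahead-counts z<s (subst (_< suc (suc j)) eq (oldIndex-<-newIndex k (suc j) i<j′))

        ahead-counts′ : ∀ {i} → 1 ≤ i → i < j′ → count (step s) (deck (step s) i) ≤ p
        ahead-counts′ {i} 1≤i i<j′ rewrite count-step-other s (<⇒≢ 1≤i ∘′ sym ∘′ deck-step-injective s inj)
                                   | deck-step s i = old-count≤ i<j′

  seen-after : ∀ {s} → Waiting s 1 → deck (step s) 0 ≡ n × count (step s) n ≡ 1
  seen-after {s} w = front≡n , trans (subst (λ c → count (step s) c ≡ suc (count s c)) front≡n (count-step-front s))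
                                     (cong suc n-unseen)
    where
      open Waiting w
      front≡n = trans (front-step s front-seen) deck-j

  SeenBy : ℕ → Set
  SeenBy t = Σ ℕ λ t′ → 1 ≤ t′ × t′ ≤ t × SeenKthAt n 1 t′

  progress : ∀ t → SeenBy (suc t) ⊎ Σ ℕ λ j → Waiting (stateAt (suc t)) j × sightings (stateAt (suc t)) ≡ suc t
  progress zero = inj₂ (suc p , waiting-initial , sightings-initial)
  progress (suc t) with progress t
  ... | inj₁ (t′ , 1≤t′ , t′≤ , seen)   = inj₁ (t′ , 1≤t′ , m≤n⇒m≤1+n t′≤ , seen)
  ... | inj₂ (suc zero , w , _)          = inj₁ (suc (suc t) , z<s , ≤-refl , seen-after w)
  ... | inj₂ (suc (suc j) , w , sightings≡) =
        inj₂ (_ , waiting-step w (deck-injective (suc t)) , trans (sightings-step w) (cong suc sightings≡))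

  seen-by : SeenBy (suc (suc p * suc p))
  seen-by with progress (suc p * suc p)
  ... | inj₁ seen         = seen
  ... | inj₂ (_ , w , sightings≡) =
        contradiction (subst (_≤ suc p * suc p) sightings≡ (sumTo-≤ (suc p) (Waiting.counts≤ w))) (<-irrefl refl)

mainTheorem5 : (n : ℕ) → 1 ≤ n →
    Σ ℕ (λ t → 1 ≤ t × t ≤ (n ∸ 1) * (n ∸ 1) + 1 × SeenKthAt n 1 t)
mainTheorem5 (suc zero)    _ = 1 , z<s , s≤s z≤n , refl , refl
mainTheorem5 (suc (suc p)) _ with FirstSighting.seen-by p
... | t , 1≤t , t≤ , seen = t , 1≤t , ≤-trans t≤ (≤-reflexive (+-comm 1 (suc p * suc p))) , seen
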